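{- The hypercube $Q_6$ has an $L_{16}$-decomposition.
   Context: The hypercube $Q_6$ is the graph whose vertices are the binary strings of length $6$, two vertices being adjacent if and only if they differ in exactly one position. The sunlet graph $L_{16}$ is the graph obtained from a cycle of length $8$ by attaching one pendant edge (to a new vertex) at each vertex of the cycle. For a graph $H$, an $H$-decomposition of a graph $G$ is a collection of edge-disjoint subgraphs of $G$, each isomorphic to $H$, whose edge sets partition $E(G)$. -}

module Defs where

open import Data.Nat using (ℕ; zero; suc; _+_)
open import Data.Bool using (Bool; true; false)
open import Data.Fin using (Fin; toℕ)
open import Data.Vec using (Vec; []; _∷_)
open import Data.Sum using (_⊎_; inj₁; inj₂)
open import Data.Product using (Σ; _×_; _,_)
open import Data.Empty using (⊥)
open import Relation.Binary.PropositionalEquality using (_≡_)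
open import Function.Definitions using (Injective)

record Graph : Set₁ where
  field
    V   : Set
    Adj : V → V → Set
open Graph public

hamming : ∀ {n} → Vec Bool n → Vec Bool n → ℕ
hamming [] [] = 0
hamming (true ∷ u) (true ∷ v) = hamming u v
hamming (false ∷ u) (false ∷ v) = hamming u v
hamming (true ∷ u) (false ∷ v) = suc (hamming u v)
hamming (false ∷ u) (true ∷ v) = suc (hamming u v)

Q : ℕ → Graph
Q n = record { V = Vec Bool n ; Adj = λ u v → hamming u v ≡ 1 }

-- Sunlet graph L_{2n}: cycle on inj₁ 0, …, inj₁ (n-1) (i ~ i+1 mod n),
-- with a pendant vertex inj₂ i attached to inj₁ i.
-- j is the successor of i on the n-cycle 0,1,…,n-1,0
cycSucc : (n : ℕ) → Fin n → Fin n → Set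
cycSucc n i j = (toℕ j ≡ toℕ i + 1) ⊎ ((toℕ i + 1 ≡ n) × (toℕ j ≡ 0))

sunletAdj : (n : ℕ) → Fin n ⊎ Fin n → Fin n ⊎ Fin n → Set
sunletAdj n (inj₁ i) (inj₁ j) = cycSucc n i j ⊎ cycSucc n j i
sunletAdj n (inj₁ i) (inj₂ j) = i ≡ j
sunletAdj n (inj₂ i) (inj₁ j) = i ≡ j
sunletAdj n (inj₂ i) (inj₂ j) = ⊥

Sunlet : ℕ → Graph
Sunlet n = record { V = Fin n ⊎ Fin n ; Adj = sunletAdj n }

L16 : Graph
L16 = Sunlet 8

-- A copy of H in G: an injective map V(H) → V(G) sending edges to edges.
-- Its image (vertices and image edges) is a subgraph of G isomorphic to H.
record Copy (H G : Graph) : Set where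
  field
    f   : V H → V G
    inj : Injective _≡_ _≡_ f
    hom : ∀ x y → Adj H x y → Adj G (f x) (f y)
open Copy public

-- An H-decomposition of G: finitely many copies of H in G whose edge sets
-- partition E(G).  Stated on ordered pairs: every (oriented) edge (u,v) of G
-- is the image of exactly one (copy k, oriented edge (x,y) of H).
record Decomposition (H G : Graph) : Set₁ where
  field
    m      : ℕ
    copies : Fin m → Copy H G
    cover  : ∀ u v → Adj G u v →
             Σ (Fin m) λ k → Σ (V H) λ x → Σ (V H) λ y →
               Adj H x y × (f (copies k) x ≡ u) × (f (copies k) y ≡ v)
    disjoint : ∀ k k' x y x' y' → Adj H x y → Adj H x' y' →
               f (copies k) x ≡ f (copies k') x' →
               f (copies k) y ≡ f (copies k') y' →
               (k ≡ k') × (x ≡ x') × (y ≡ y')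

-- Let Γ be the group of automorphisms of Q 6 generated by the cyclic rotation of the
-- coordinates inside each half of a 6-bit string and by the translations by the strings
-- that are constant on each half; the two kinds commute, so Γ has order 12. The sunlet
-- with cycle 1 3 11 10 8 40 41 33 and pendants 0 35 27 14 9 56 45 49 (vertices written
-- as binary numbers) meets each Γ-orbit of edges exactly once, and Γ acts freely on the
-- 192 edges, so its twelve images under Γ partition E(Q 6). Covering and disjointness of
-- the images are checked by exhaustive computation.
module Submission where

open import Defs
open import Data.Bool using (Bool; true; false; not; _xor_)
open import Data.Bool.Properties
  using (xor-assoc; xor-same; xor-identityʳ; xor-inverseˡ; xor-inverseʳ)
open import Data.Nat using (ℕ; zero; suc; _+_; _%_; _/_; _≡ᵇ_)
import Data.Nat.Properties as ℕ
open import Data.Fin using (Fin; toℕ; remQuot)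
import Data.Fin.Properties as Fin
open import Data.Vec using (Vec; []; _∷_; lookup; tabulate; zipWith)
import Data.Vec.Properties as Vec
open import Data.Sum using (_⊎_; inj₁; inj₂)
import Data.Sum.Properties as Sum
open import Data.Product using (Σ; _×_; _,_)
open import Function using (_∘_; id)
open import Function.Definitions using (Injective)
open import Relation.Binary using (Decidable; DecidableEquality)
open import Relation.Binary.PropositionalEquality
  using (_≡_; _≗_; refl; sym; trans; cong; cong₂; subst₂; module ≡-Reasoning)
open import Relation.Nullary using (Dec; no; map′; _×-dec_; _⊎-dec_; _→-dec_)
open import Relation.Nullary.Decidable using (toWitness)
open import Relation.Unary using (Pred)
import Relation.Unary as U

private
  variable
    n : ℕ

all-Vec-Bool? : ∀ {p} {P : Pred (Vec Bool n) p} → U.Decidable P → Dec (∀ v → P v)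
all-Vec-Bool? {zero} P? = map′ (λ { p [] → p }) (λ h → h []) (P? [])
all-Vec-Bool? {suc n} P? =
  map′ (λ { (h₁ , h₀) (true ∷ v) → h₁ v ; (h₁ , h₀) (false ∷ v) → h₀ v })
       (λ h → h ∘ (true ∷_) , h ∘ (false ∷_))
       (all-Vec-Bool? (P? ∘ (true ∷_)) ×-dec all-Vec-Bool? (P? ∘ (false ∷_)))

module _ {a b p} {A : Set a} {B : Set b} {P : Pred (A ⊎ B) p} where

  all-⊎? : Dec (∀ x → P (inj₁ x)) → Dec (∀ y → P (inj₂ y)) → Dec (∀ z → P z)
  all-⊎? l? r? = map′ (λ { (l , r) (inj₁ x) → l x ; (l , r) (inj₂ y) → r y })
                      (λ h → h ∘ inj₁ , h ∘ inj₂) (l? ×-dec r?)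

  any-⊎? : Dec (Σ A (P ∘ inj₁)) → Dec (Σ B (P ∘ inj₂)) → Dec (Σ (A ⊎ B) P)
  any-⊎? l? r? = map′ (λ { (inj₁ (x , p)) → inj₁ x , p ; (inj₂ (y , p)) → inj₂ y , p })
                      (λ { (inj₁ x , p) → inj₁ (x , p) ; (inj₂ y , p) → inj₂ (y , p) })
                      (l? ⊎-dec r?)

weight : Vec Bool n → ℕ
weight []          = 0
weight (true ∷ w)  = suc (weight w)
weight (false ∷ w) = weight w

infixl 6 _⊕_
_⊕_ : Vec Bool n → Vec Bool n → Vec Bool n
_⊕_ = zipWith _xor_

hamming≡weight-⊕ : (u v : Vec Bool n) → hamming u v ≡ weight (u ⊕ v)
hamming≡weight-⊕ []          []          = refl
hamming≡weight-⊕ (true ∷ u)  (true ∷ v)  = hamming≡weight-⊕ u v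
hamming≡weight-⊕ (true ∷ u)  (false ∷ v) = cong suc (hamming≡weight-⊕ u v)
hamming≡weight-⊕ (false ∷ u) (true ∷ v)  = cong suc (hamming≡weight-⊕ u v)
hamming≡weight-⊕ (false ∷ u) (false ∷ v) = hamming≡weight-⊕ u v

⊕-cancelʳ : (u t : Vec Bool n) → u ⊕ t ⊕ t ≡ u
⊕-cancelʳ []      []      = refl
⊕-cancelʳ (a ∷ u) (b ∷ t) = cong₂ _∷_ xor-cancelʳ (⊕-cancelʳ u t)
  where
  xor-cancelʳ : (a xor b) xor b ≡ a
  xor-cancelʳ = trans (xor-assoc a b b) (trans (cong (a xor_) (xor-same b)) (xor-identityʳ a))

⊕-translation-invariant : (t u v : Vec Bool n) → (u ⊕ t) ⊕ (v ⊕ t) ≡ u ⊕ v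
⊕-translation-invariant []      []      []      = refl
⊕-translation-invariant (c ∷ t) (a ∷ u) (b ∷ v) =
  cong₂ _∷_ (xor-translation-invariant a b) (⊕-translation-invariant t u v)
  where
  xor-translation-invariant : ∀ a b → (a xor c) xor (b xor c) ≡ a xor b
  xor-translation-invariant true  true  = xor-same (not c)
  xor-translation-invariant true  false = xor-inverseˡ c
  xor-translation-invariant false true  = xor-inverseʳ c
  xor-translation-invariant false false = xor-same c

weight-swap : ∀ a b (w : Vec Bool n) → weight (a ∷ b ∷ w) ≡ weight (b ∷ a ∷ w)
weight-swap true  true  w = refl
weight-swap true  false w = refl
weight-swap false true  w = refl
weight-swap false false w = refl

weight-∷ : ∀ a {u v : Vec Bool n} → weight u ≡ weight v → weight (a ∷ u) ≡ weight (a ∷ v)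
weight-∷ true  = cong suc
weight-∷ false = id

rotate : ∀ {a} {A : Set a} → Vec A 6 → Vec A 6
rotate (x₀ ∷ x₁ ∷ x₂ ∷ x₃ ∷ x₄ ∷ x₅ ∷ []) = x₂ ∷ x₀ ∷ x₁ ∷ x₅ ∷ x₃ ∷ x₄ ∷ []

rotate³≡id : ∀ {a} {A : Set a} (u : Vec A 6) → rotate (rotate (rotate u)) ≡ u
rotate³≡id (_ ∷ _ ∷ _ ∷ _ ∷ _ ∷ _ ∷ []) = refl

rotate-⊕ : (u v : Vec Bool 6) → rotate u ⊕ rotate v ≡ rotate (u ⊕ v)
rotate-⊕ (_ ∷ _ ∷ _ ∷ _ ∷ _ ∷ _ ∷ []) (_ ∷ _ ∷ _ ∷ _ ∷ _ ∷ _ ∷ []) = refl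

weight-rotate : (w : Vec Bool 6) → weight (rotate w) ≡ weight w
weight-rotate (x₀ ∷ x₁ ∷ x₂ ∷ x₃ ∷ x₄ ∷ x₅ ∷ []) = begin
  weight (x₂ ∷ x₀ ∷ x₁ ∷ x₅ ∷ x₃ ∷ x₄ ∷ []) ≡⟨ weight-swap x₂ x₀ _ ⟩
  weight (x₀ ∷ x₂ ∷ x₁ ∷ x₅ ∷ x₃ ∷ x₄ ∷ []) ≡⟨ weight-∷ x₀ (weight-swap x₂ x₁ _) ⟩
  weight (x₀ ∷ x₁ ∷ x₂ ∷ x₅ ∷ x₃ ∷ x₄ ∷ []) ≡⟨ weight-∷ x₀ (weight-∷ x₁ (weight-∷ x₂ (weight-swap x₅ x₃ _))) ⟩
  weight (x₀ ∷ x₁ ∷ x₂ ∷ x₃ ∷ x₅ ∷ x₄ ∷ []) ≡⟨ weight-∷ x₀ (weight-∷ x₁ (weight-∷ x₂ (weight-∷ x₃ (weight-swap x₅ x₄ _)))) ⟩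
  weight (x₀ ∷ x₁ ∷ x₂ ∷ x₃ ∷ x₄ ∷ x₅ ∷ []) ∎
  where open ≡-Reasoning

hamming-⊕ʳ : (t u v : Vec Bool n) → hamming (u ⊕ t) (v ⊕ t) ≡ hamming u v
hamming-⊕ʳ t u v = begin
  hamming (u ⊕ t) (v ⊕ t)  ≡⟨ hamming≡weight-⊕ (u ⊕ t) (v ⊕ t) ⟩
  weight ((u ⊕ t) ⊕ (v ⊕ t)) ≡⟨ cong weight (⊕-translation-invariant t u v) ⟩
  weight (u ⊕ v)           ≡⟨ sym (hamming≡weight-⊕ u v) ⟩
  hamming u v              ∎
  where open ≡-Reasoning

hamming-rotate : (u v : Vec Bool 6) → hamming (rotate u) (rotate v) ≡ hamming u v
hamming-rotate u v = begin
  hamming (rotate u) (rotate v)    ≡⟨ hamming≡weight-⊕ (rotate u) (rotate v) ⟩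
  weight (rotate u ⊕ rotate v)     ≡⟨ cong weight (rotate-⊕ u v) ⟩
  weight (rotate (u ⊕ v))          ≡⟨ weight-rotate (u ⊕ v) ⟩
  weight (u ⊕ v)                   ≡⟨ sym (hamming≡weight-⊕ u v) ⟩
  hamming u v                      ∎
  where open ≡-Reasoning

idᶜ : ∀ {G} → Copy G G
idᶜ = record { f = id ; inj = id ; hom = λ _ _ → id }

infixr 9 _∘ᶜ_
_∘ᶜ_ : ∀ {H G K} → Copy G K → Copy H G → Copy H K
φ ∘ᶜ ψ = record
  { f   = f φ ∘ f ψ
  ; inj = inj ψ ∘ inj φ
  ; hom = λ x y a → hom φ _ _ (hom ψ x y a)
  }

_^ᶜ_ : ∀ {G} → Copy G G → ℕ → Copy G G
φ ^ᶜ zero  = idᶜ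
φ ^ᶜ suc k = φ ∘ᶜ φ ^ᶜ k

Copy-≗ : ∀ {H G} (φ : Copy H G) {g : V H → V G} → f φ ≗ g → Copy H G
Copy-≗ {G = G} φ {g} e = record
  { f   = g
  ; inj = λ {x} {y} p → inj φ (trans (e x) (trans p (sym (e y))))
  ; hom = λ x y a → subst₂ (Adj G) (e x) (e y) (hom φ x y a)
  }

translation : Vec Bool n → Copy (Q n) (Q n)
translation t = record
  { f   = _⊕ t
  ; inj = λ {u} {v} e → trans (sym (⊕-cancelʳ u t)) (trans (cong (_⊕ t) e) (⊕-cancelʳ v t))
  ; hom = λ u v h → trans (hamming-⊕ʳ t u v) h
  }

rotation : Copy (Q 6) (Q 6)
rotation = record
  { f   = rotate
  ; inj = λ {u} {v} e → trans (sym (rotate³≡id u)) (trans (cong (rotate ∘ rotate) e) (rotate³≡id v))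
  ; hom = λ u v h → trans (hamming-rotate u v) h
  }

module _ {a} {A : Set a} {m n : ℕ} where

  tabulate-⊎ : (Fin m ⊎ Fin n → A) → Vec A m × Vec A n
  tabulate-⊎ g = tabulate (g ∘ inj₁) , tabulate (g ∘ inj₂)

  lookup-⊎ : Vec A m × Vec A n → Fin m ⊎ Fin n → A
  lookup-⊎ (xs , ys) (inj₁ i) = lookup xs i
  lookup-⊎ (xs , ys) (inj₂ j) = lookup ys j

  lookup-⊎∘tabulate-⊎ : ∀ g → lookup-⊎ (tabulate-⊎ g) ≗ g
  lookup-⊎∘tabulate-⊎ g (inj₁ i) = Vec.lookup∘tabulate (g ∘ inj₁) i
  lookup-⊎∘tabulate-⊎ g (inj₂ j) = Vec.lookup∘tabulate (g ∘ inj₂) j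

cycSucc? : ∀ n → Decidable (cycSucc n)
cycSucc? n i j = (toℕ j ℕ.≟ toℕ i + 1) ⊎-dec ((toℕ i + 1 ℕ.≟ n) ×-dec (toℕ j ℕ.≟ 0))

sunletAdj? : ∀ n → Decidable (sunletAdj n)
sunletAdj? n (inj₁ i) (inj₁ j) = cycSucc? n i j ⊎-dec cycSucc? n j i
sunletAdj? n (inj₁ i) (inj₂ j) = i Fin.≟ j
sunletAdj? n (inj₂ i) (inj₁ j) = i Fin.≟ j
sunletAdj? n (inj₂ i) (inj₂ j) = no λ ()

all-L16? : ∀ {p} {P : Pred (V L16) p} → U.Decidable P → Dec (∀ x → P x)
all-L16? P? = all-⊎? (Fin.all? (P? ∘ inj₁)) (Fin.all? (P? ∘ inj₂))

any-L16? : ∀ {p} {P : Pred (V L16) p} → U.Decidable P → Dec (Σ (V L16) P)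
any-L16? P? = any-⊎? (Fin.any? (P? ∘ inj₁)) (Fin.any? (P? ∘ inj₂))

_≟ᵛ_ : DecidableEquality (V L16)
_≟ᵛ_ = Sum.≡-dec Fin._≟_ Fin._≟_

_≟ᵇ_ : DecidableEquality (Vec Bool n)
_≟ᵇ_ = Vec.≡-dec Data.Bool._≟_

VertexMaps : ℕ → Set
VertexMaps m = Vec (Vec (Vec Bool 6) 8 × Vec (Vec Bool 6) 8) m

lookupMap : ∀ {m} → VertexMaps m → Fin m → V L16 → Vec Bool 6
lookupMap T k = lookup-⊎ (lookup T k)

tabulateMaps : ∀ {m} → (Fin m → V L16 → Vec Bool 6) → VertexMaps m
tabulateMaps g = tabulate (tabulate-⊎ ∘ g)

lookupMap∘tabulateMaps : ∀ {m} (g : Fin m → V L16 → Vec Bool 6) k → lookupMap (tabulateMaps g) k ≗ g k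
lookupMap∘tabulateMaps g k x = begin
  lookup-⊎ (lookup (tabulate (tabulate-⊎ ∘ g)) k) x ≡⟨ cong (λ r → lookup-⊎ r x) (Vec.lookup∘tabulate _ k) ⟩
  lookup-⊎ (tabulate-⊎ (g k)) x                     ≡⟨ lookup-⊎∘tabulate-⊎ (g k) x ⟩
  g k x                                             ∎
  where open ≡-Reasoning

Covering : ∀ {m} → VertexMaps m → Set
Covering {m} T = ∀ u v → hamming u v ≡ 1 →
  Σ (Fin m) λ k → Σ (V L16) λ x → Σ (V L16) λ y →
    sunletAdj 8 x y × (lookupMap T k x ≡ u) × (lookupMap T k y ≡ v)

EdgeDisjoint : ∀ {m} → VertexMaps m → Set
EdgeDisjoint T = ∀ k k' x y x' y' → sunletAdj 8 x y → sunletAdj 8 x' y' →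
  lookupMap T k x ≡ lookupMap T k' x' → lookupMap T k y ≡ lookupMap T k' y' →
  (k ≡ k') × (x ≡ x') × (y ≡ y')

-- The table is an argument, not a global constant, so that the type checker evaluates
-- each of its entries only once during the exhaustive checks.
covering? : ∀ {m} (T : VertexMaps m) → Dec (Covering T)
covering? T = all-Vec-Bool? λ u → all-Vec-Bool? λ v → (hamming u v ℕ.≟ 1) →-dec
  map′ (λ (k , x , p , y , q , a) → k , x , y , a , p , q)
       (λ (k , x , y , a , p , q) → k , x , p , y , q , a)
       (Fin.any? λ k → any-L16? λ x → (lookupMap T k x ≟ᵇ u) ×-dec
                       any-L16? λ y → (lookupMap T k y ≟ᵇ v) ×-dec sunletAdj? 8 x y)

edgeDisjoint? : ∀ {m} (T : VertexMaps m) → Dec (EdgeDisjoint T)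
edgeDisjoint? T = map′ (λ h k k' x y x' y' a a' p q → h k x y a k' x' p y' q a')
                       (λ h k x y a k' x' p y' q a' → h k k' x y x' y' a a' p q)
  (Fin.all? λ k → all-L16? λ x → all-L16? λ y → sunletAdj? 8 x y →-dec
   Fin.all? λ k' → all-L16? λ x' → (lookupMap T k x ≟ᵇ lookupMap T k' x') →-dec
   all-L16? λ y' → (lookupMap T k y ≟ᵇ lookupMap T k' y') →-dec sunletAdj? 8 x' y' →-dec
   (k Fin.≟ k') ×-dec (x ≟ᵛ x') ×-dec (y ≟ᵛ y'))

-- Vertex k of Q 6 is the binary expansion of k, least significant bit first.
bits : ∀ n → ℕ → Vec Bool n
bits zero    _ = []
bits (suc n) k = (k % 2 ≡ᵇ 1) ∷ bits n (k / 2)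

baseVertex : V L16 → Vec Bool 6
baseVertex (inj₁ i) = bits 6 (lookup (1 ∷ 3 ∷ 11 ∷ 10 ∷ 8 ∷ 40 ∷ 41 ∷ 33 ∷ []) i)
baseVertex (inj₂ i) = bits 6 (lookup (0 ∷ 35 ∷ 27 ∷ 14 ∷ 9 ∷ 56 ∷ 45 ∷ 49 ∷ []) i)

baseVertex-injective : Injective _≡_ _≡_ baseVertex
baseVertex-injective {x} {y} = toWitness {a? = all-L16? λ x → all-L16? λ y →
  (baseVertex x ≟ᵇ baseVertex y) →-dec (x ≟ᵛ y)} _ x y

baseVertex-homomorphic : ∀ x y → sunletAdj 8 x y → hamming (baseVertex x) (baseVertex y) ≡ 1
baseVertex-homomorphic = toWitness {a? = all-L16? λ x → all-L16? λ y →
  sunletAdj? 8 x y →-dec (hamming (baseVertex x) (baseVertex y) ℕ.≟ 1)} _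

base : Copy L16 (Q 6)
base = record { f = baseVertex ; inj = baseVertex-injective ; hom = baseVertex-homomorphic }

halfConstant : Fin 4 → Vec Bool 6
halfConstant = lookup (bits 6 0 ∷ bits 6 7 ∷ bits 6 56 ∷ bits 6 63 ∷ [])

orbitCopy : Fin 12 → Copy L16 (Q 6)
orbitCopy k = let (r , s) = remQuot {3} 4 k in translation (halfConstant s) ∘ᶜ rotation ^ᶜ toℕ r ∘ᶜ base

images : VertexMaps 12
images = tabulateMaps (f ∘ orbitCopy)

copies : Fin 12 → Copy L16 (Q 6)
copies k = Copy-≗ (orbitCopy k) (sym ∘ lookupMap∘tabulateMaps (f ∘ orbitCopy) k)

lemma6 : Decomposition L16 (Q 6)
lemma6 = record
  { m        = 12
  ; copies   = copies
  ; cover    = toWitness {a? = covering? images} _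
  ; disjoint = toWitness {a? = edgeDisjoint? images} _
  }
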